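{- For any positive integers $r\le d$, the ordinary generating function $G_{d,r}(x)=\sum_{s=1}^{\infty}N_{d,r}(s)x^s$ equals $$G_{d,r}(x)=\frac{x\bigl(1+(r-1)x^d-rx^{d+1}\bigr)}{(1-x-x^{d+1})(1-x)}$$ (as formal power series).
   Context: A partition $\lambda=(\lambda_1,\dots,\lambda_k)$ is a finite nonincreasing sequence of positive integers (the empty partition is allowed). In its Young diagram (row $i$ has $\lambda_i$ left-justified cells), the hook length $h(i,j)$ of cell $(i,j)$ is $1$ plus the number of cells to its right in its row plus the number of cells below it in its column. For a positive integer $t$, $\lambda$ is $t$-core if no cell has hook length $t$; it is $(s,s+r)$-core if it is both $s$-core and $(s+r)$-core. $\lambda$ has $d$-distinct parts if $\lambda_i-\lambda_{i+1}\ge d$ for all $1\le i\le k-1$. For positive integers $d,r,s$, $N_{d,r}(s)$ is the number of $(s,s+r)$-core partitions with $d$-distinct parts. -}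

module Defs where

open import Data.Nat as ℕ using (ℕ; zero; suc; _+_; _∸_; _≤_; _<_)
open import Data.Integer as ℤ using (ℤ; +_) renaming (_+_ to _+ℤ_; _*_ to _*ℤ_; -_ to -ℤ_)
open import Data.List using (List; []; _∷_; length; filter; drop)
open import Data.List.Relation.Unary.All using (All)
open import Data.List.Relation.Unary.Linked using (Linked)
open import Data.List.Relation.Unary.Unique.Propositional using (Unique)
open import Data.List.Membership.Propositional using (_∈_)
open import Data.Product using (Σ; _×_; ∃; ∃-syntax)
open import Data.Unit using (⊤)
open import Relation.Binary.PropositionalEquality using (_≡_)
open import Relation.Nullary using (¬_)
open import Relation.Nullary.Decidable using (does)
open import Data.Bool using (if_then_else_)
open import Function.Bundles using (_⇔_)

IsPartition : List ℕ → Set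
IsPartition λ′ = Linked (λ a b → b ≤ a) λ′ × All (λ a → 1 ≤ a) λ′

-- i-th part, 0 if out of range
part : List ℕ → ℕ → ℕ
part []       _       = 0
part (x ∷ _)  zero    = x
part (_ ∷ xs) (suc i) = part xs i

-- Hook length of cell (i , j) (0-indexed; cell exists iff j < part λ i):
-- 1 + (cells to the right in row i) + (cells below in column j).
hook : List ℕ → ℕ → ℕ → ℕ
hook λ′ i j = suc ((part λ′ i ∸ suc j) + length (filter (λ k → j ℕ.<? k) (drop (suc i) λ′)))

IsCore : ℕ → List ℕ → Set
IsCore t λ′ = ¬ (∃[ i ] ∃[ j ] (j < part λ′ i × hook λ′ i j ≡ t))

DDistinct : ℕ → List ℕ → Set
DDistinct d []           = ⊤
DDistinct d (x ∷ [])     = ⊤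
DDistinct d (x ∷ y ∷ xs) = (y + d ≤ x) × DDistinct d (y ∷ xs)

CoreDD : ℕ → ℕ → ℕ → List ℕ → Set
CoreDD d r s λ′ = IsPartition λ′ × IsCore s λ′ × IsCore (s + r) λ′ × DDistinct d λ′

-- "P holds for exactly n objects": a duplicate-free list enumerating P has length n
HasCount : (List ℕ → Set) → ℕ → Set
HasCount P n = Σ (List (List ℕ)) λ L → Unique L × (∀ x → (x ∈ L) ⇔ P x) × length L ≡ n

Series : Set
Series = ℕ → ℤ

mon : ℤ → ℕ → Series
mon c k n = if does (n ℕ.≟ k) then c else + 0

_⊕_ : Series → Series → Series
(f ⊕ g) n = f n +ℤ g n

_⊖_ : Series → Series → Series
(f ⊖ g) n = f n +ℤ (-ℤ g n)

convAux : Series → Series → ℕ → ℕ → ℤ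
convAux f g n zero    = + 0
convAux f g n (suc m) = convAux f g n m +ℤ (f m *ℤ g (n ∸ m))

_⊛_ : Series → Series → Series
(f ⊛ g) n = convAux f g n (suc n)

infixl 6 _⊕_ _⊖_
infixl 7 _⊛_

denom : ℕ → Series
denom d = (mon (+ 1) 0 ⊖ mon (+ 1) 1 ⊖ mon (+ 1) (suc d)) ⊛ (mon (+ 1) 0 ⊖ mon (+ 1) 1)

numer : ℕ → ℕ → Series
numer d r = mon (+ 1) 1 ⊛ (mon (+ 1) 0 ⊕ mon (+ (r ∸ 1)) d ⊖ mon (+ r) (suc d))

-- A partition with distinct parts is determined by its β-set, the list of first-column hook
-- lengths, and it is a t-core iff its β-set is closed under subtracting t: the hook lengths in
-- the row with β-entry b are exactly the differences b - y with y < b outside the β-set.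
-- Parts differing by at least d become β-entries differing by more than d ("spaced").
-- For an (s, s+r)-core with r ≤ d the largest β-entry is either below s, and then the β-set is
-- any spaced set in [1, s-1], or equal to s + m with 1 ≤ m < r: closure forces m into the set,
-- spacing makes m its smallest entry, and the entries in between form any spaced set in
-- [m+d+1, s+m-d-1]. With a(w) the number of spaced subsets of an interval of length w, which
-- satisfies a(w+1) = a(w) + a(w-d), this gives N(s) = a(s-1) + (r-1) a(s-2d-1) and from it
-- N(k+1) = N(k) + N(k-d) + [k < d] + r [k = d] (with N(0) = 0), that is,
-- G(x) (1 - x - x^(d+1)) = x (1 + x + ... + x^(d-1) + r x^d); multiplying by 1 - x gives the
-- stated numerator.

module Submission where

open import Data.Empty using (⊥; ⊥-elim)
open import Data.Integer as ℤ using (ℤ)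
import Data.Integer.Properties as ℤₚ
import Data.Integer.Tactic.RingSolver as ℤ-Solver
open import Data.List using (List; []; _∷_; [_]; _++_; length; filter; map)
open import Data.List.Membership.Propositional using (_∈_; _∉_)
open import Data.List.Membership.Propositional.Properties using (∈-map⁺; ∈-map⁻; ∈-++⁺ˡ; ∈-++⁺ʳ; ∈-++⁻)
open import Data.List.Properties
  using (filter-accept; filter-reject; length-++; length-map; map-∘; map-id-local; ∷-injective; ∷-injectiveʳ; ∷ʳ-injective)
open import Data.List.Relation.Unary.All as All using (All; []; _∷_)
import Data.List.Relation.Unary.All.Properties as AllP
open import Data.List.Relation.Unary.AllPairs using ([]; _∷_)
open import Data.List.Relation.Unary.Any using (here; there)
open import Data.List.Relation.Unary.Linked as Linked using (Linked; []; [-]; _∷_)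
open import Data.List.Relation.Unary.Linked.Properties using (Linked⇒All)
open import Data.List.Relation.Unary.Unique.Propositional using (Unique)
import Data.List.Relation.Unary.Unique.Propositional.Properties as Unique
open import Data.Nat as ℕ
  using (ℕ; zero; suc; _+_; _*_; _∸_; _≤_; _<_; z≤n; s≤s; z<s; _≤?_; _<?_; _≟_)
open import Data.Nat.Properties
open import Data.Nat.Tactic.RingSolver using (solve-∀)
open import Data.List.Membership.DecPropositional _≟_ using (_∈?_)
open import Data.Product using (Σ; ∃; _×_; _,_; proj₁; proj₂)
open import Data.Sum using (_⊎_; inj₁; inj₂)
open import Data.Unit using (⊤; tt)
open import Function using (_∘_)
open import Function.Bundles using (mk⇔)
open import Relation.Binary.Definitions using (Transitive; Tri; tri<; tri≈; tri>)
open import Relation.Binary.PropositionalEquality hiding ([_])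
open import Relation.Nullary using (¬_; Dec; yes; no)
open import Relation.Nullary.Decidable using (dec-true; dec-false)

open import Defs

∸-∸-comm : ∀ m n o → m ∸ n ∸ o ≡ m ∸ o ∸ n
∸-∸-comm m n o = trans (∸-+-assoc m n o) (trans (cong (m ∸_) (+-comm n o)) (sym (∸-+-assoc m o n)))

StrictPartition : List ℕ → Set
StrictPartition []       = ⊤
StrictPartition (x ∷ xs) = 1 ≤ x × All (_< x) xs × StrictPartition xs

StrictPartition⇒positive : ∀ μ → StrictPartition μ → All (1 ≤_) μ
StrictPartition⇒positive []       _           = []
StrictPartition⇒positive (x ∷ xs) (1≤x , _ , sp) = 1≤x ∷ StrictPartition⇒positive xs sp

count> : ℕ → List ℕ → ℕ
count> j μ = length (filter (j <?_) μ)

count≤ : ℕ → List ℕ → ℕ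
count≤ j []      = 0
count≤ j (p ∷ μ) with p ≤? j
... | yes _ = suc (count≤ j μ)
... | no  _ = count≤ j μ

count≤-accept : ∀ {j p} μ → p ≤ j → count≤ j (p ∷ μ) ≡ suc (count≤ j μ)
count≤-accept {j} {p} μ p≤j with p ≤? j
... | yes _   = refl
... | no  p≰j = ⊥-elim (p≰j p≤j)

count≤-reject : ∀ {j p} μ → ¬ p ≤ j → count≤ j (p ∷ μ) ≡ count≤ j μ
count≤-reject {j} {p} μ p≰j with p ≤? j
... | yes p≤j = ⊥-elim (p≰j p≤j)
... | no  _   = refl

count>+count≤ : ∀ j μ → count> j μ + count≤ j μ ≡ length μ
count>+count≤ j []      = refl
count>+count≤ j (p ∷ μ) with j <? p
... | yes j<p rewrite filter-accept (j <?_) {xs = μ} j<p | count≤-reject {j} μ (<⇒≱ j<p) =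
  cong suc (count>+count≤ j μ)
... | no  j≮p rewrite filter-reject (j <?_) {xs = μ} j≮p | count≤-accept {j} μ (≮⇒≥ j≮p) =
  trans (+-suc _ _) (cong suc (count>+count≤ j μ))

count≤-mono : ∀ μ {j j′} → j ≤ j′ → count≤ j μ ≤ count≤ j′ μ
count≤-mono []      j≤j′ = z≤n
count≤-mono (p ∷ μ) {j} {j′} j≤j′ with p ≤? j | p ≤? j′
... | yes _   | yes _    = s≤s (count≤-mono μ j≤j′)
... | yes p≤j | no  p≰j′ = ⊥-elim (p≰j′ (≤-trans p≤j j≤j′))
... | no  _   | yes _    = m≤n⇒m≤1+n (count≤-mono μ j≤j′)
... | no  _   | no  _    = count≤-mono μ j≤j′

count≤-all : ∀ j μ → All (_≤ j) μ → count≤ j μ ≡ length μ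
count≤-all j []      []           = refl
count≤-all j (p ∷ μ) (p≤j ∷ μ≤j) rewrite count≤-accept {j} μ p≤j = cong suc (count≤-all j μ μ≤j)

count≤-zero : ∀ μ → All (1 ≤_) μ → count≤ 0 μ ≡ 0
count≤-zero []      []           = refl
count≤-zero (p ∷ μ) (1≤p ∷ μ-pos) rewrite count≤-reject {0} μ (<⇒≱ 1≤p) = count≤-zero μ μ-pos

count≤-suc : ∀ j μ → StrictPartition μ →
  count≤ (suc j) μ ≡ count≤ j μ ⊎ (count≤ (suc j) μ ≡ suc (count≤ j μ) × suc j ∈ μ)
count≤-suc j []      _ = inj₁ refl
count≤-suc j (p ∷ μ) (_ , μ<p , sp) with p ≤? j | p ≤? suc j | count≤-suc j μ sp
... | yes _   | yes _   | inj₁ eq         = inj₁ (cong suc eq)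
... | yes _   | yes _   | inj₂ (eq , j∈) = inj₂ (cong suc eq , there j∈)
... | yes p≤j | no  p≰  | _               = ⊥-elim (p≰ (m≤n⇒m≤1+n p≤j))
... | no  _   | no  _   | inj₁ eq         = inj₁ eq
... | no  _   | no  _   | inj₂ (eq , j∈) = inj₂ (eq , there j∈)
... | no  p≰j | yes p≤  | _               =
  inj₂ (cong suc (trans (count≤-all (suc j) μ (All.map m≤n⇒m≤1+n μ≤j)) (sym (count≤-all j μ μ≤j))) ,
        here (sym p≡))
  where
  p≡ : p ≡ suc j
  p≡ = ≤-antisym p≤ (≰⇒> p≰j)
  μ≤j : All (_≤ j) μ
  μ≤j = All.map ≤-pred (subst (λ q → All (_< q) μ) p≡ μ<p)

count≤-jump : ∀ q μ → suc q ∈ μ → suc (count≤ q μ) ≤ count≤ (suc q) μ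
count≤-jump q (p ∷ μ) (here refl) rewrite count≤-reject {q} μ 1+n≰n | count≤-accept {suc q} μ ≤-refl =
  s≤s (count≤-mono μ (n≤1+n q))
count≤-jump q (p ∷ μ) (there q∈) with p ≤? q | p ≤? suc q
... | yes _   | yes _  = s≤s (count≤-jump q μ q∈)
... | yes p≤q | no p≰  = ⊥-elim (p≰ (m≤n⇒m≤1+n p≤q))
... | no  _   | yes _  = m≤n⇒m≤1+n (count≤-jump q μ q∈)
... | no  _   | no  _  = count≤-jump q μ q∈

β-set : List ℕ → List ℕ
β-set []      = []
β-set (x ∷ μ) = x + length μ ∷ β-set μ

-- hole j μ is the j-th smallest natural number outside β-set μ (counting from 0).
hole : ℕ → List ℕ → ℕ
hole j μ = j + count≤ j μ

part⇒∈β-set : ∀ q μ → StrictPartition μ → suc q ∈ μ → suc (hole q μ) ∈ β-set μ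
part⇒∈β-set q (p ∷ μ) (_ , μ<p , _) (here refl) rewrite count≤-reject {q} μ 1+n≰n =
  here (cong (suc ∘ (q +_)) (count≤-all q μ (All.map ≤-pred μ<p)))
part⇒∈β-set q (p ∷ μ) (_ , μ<p , sp) (there q∈)
  rewrite count≤-reject {q} μ (<⇒≱ (<-trans (n<1+n q) (All.lookup μ<p q∈))) =
  there (part⇒∈β-set q μ sp q∈)

∈β-set⇒part : ∀ b μ → StrictPartition μ → b ∈ β-set μ → ∃ λ q → suc q ∈ μ × b ≡ suc (hole q μ)
∈β-set⇒part b (suc q ∷ μ) (_ , μ<p , _) (here refl) =
  q , here refl , cong (suc ∘ (q +_)) (sym (trans (count≤-reject {q} μ 1+n≰n) (count≤-all q μ (All.map ≤-pred μ<p))))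
∈β-set⇒part b (p ∷ μ) (_ , μ<p , sp) (there b∈) with ∈β-set⇒part b μ sp b∈
... | q , q∈ , refl =
  q , there q∈ , cong (suc ∘ (q +_)) (sym (count≤-reject {q} μ (<⇒≱ (<-trans (n<1+n q) (All.lookup μ<p q∈)))))

hole-mono : ∀ μ {j j′} → j ≤ j′ → hole j μ ≤ hole j′ μ
hole-mono μ j≤j′ = +-mono-≤ j≤j′ (count≤-mono μ j≤j′)

hole-jump : ∀ q μ → suc q ∈ μ → suc (suc (hole q μ)) ≤ hole (suc q) μ
hole-jump q μ q∈ = s≤s (≤-trans (≤-reflexive (sym (+-suc q (count≤ q μ)))) (+-monoʳ-≤ q (count≤-jump q μ q∈)))

hole∉β-set : ∀ j μ → StrictPartition μ → hole j μ ∉ β-set μ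
hole∉β-set j μ sp h∈ with ∈β-set⇒part (hole j μ) μ sp h∈
... | q , q∈ , eq with j ≤? q
...   | yes j≤q = 1+n≰n (≤-trans (≤-reflexive (sym eq)) (hole-mono μ j≤q))
...   | no  j≰q =
  1+n≰n (≤-trans (hole-jump q μ q∈) (≤-trans (hole-mono μ (≰⇒> j≰q)) (≤-reflexive eq)))

hole-complete : ∀ j μ → StrictPartition μ → ∀ y → y ≤ hole j μ → y ∉ β-set μ →
  ∃ λ j′ → j′ ≤ j × hole j′ μ ≡ y
hole-complete zero μ sp y y≤ _ =
  0 , z≤n , trans h₀≡0 (sym (n≤0⇒n≡0 (≤-trans y≤ (≤-reflexive h₀≡0))))
  where
  h₀≡0 : hole 0 μ ≡ 0
  h₀≡0 = count≤-zero μ (StrictPartition⇒positive μ sp)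
hole-complete (suc j) μ sp y y≤ y∉ with y ≤? hole j μ
... | yes y≤′ with hole-complete j μ sp y y≤′ y∉
...   | j′ , j′≤j , eq = j′ , m≤n⇒m≤1+n j′≤j , eq
hole-complete (suc j) μ sp y y≤ y∉ | no y≰ with count≤-suc j μ sp
... | inj₁ eq = suc j , ≤-refl , ≤-antisym (subst (λ c → suc j + c ≤ y) (sym eq) (≰⇒> y≰)) y≤
... | inj₂ (eq , j∈) with y ≟ hole (suc j) μ
...   | yes y≡ = suc j , ≤-refl , sym y≡
...   | no  y≢ = ⊥-elim (y∉ (subst (_∈ β-set μ) (sym y≡) (part⇒∈β-set j μ sp j∈)))
  where
  y≡ : y ≡ suc (hole j μ)
  y≡ = ≤-antisym
    (≤-pred (≤-trans (≤∧≢⇒< y≤ y≢) (≤-reflexive (trans (cong (suc j +_) eq) (cong suc (+-suc j (count≤ j μ)))))))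
    (≰⇒> y≰)

hook₀+hole : ∀ x μ j → j < x → hook (x ∷ μ) 0 j + hole j μ ≡ x + length μ
hook₀+hole x μ j j<x = begin
  suc (x ∸ suc j + count> j μ) + (j + count≤ j μ)  ≡⟨ regroup (x ∸ suc j) (count> j μ) j (count≤ j μ) ⟩
  (x ∸ suc j + suc j) + (count> j μ + count≤ j μ)  ≡⟨ cong₂ _+_ (m∸n+n≡m j<x) (count>+count≤ j μ) ⟩
  x + length μ                                      ∎
  where
  open ≡-Reasoning
  regroup : ∀ a c j l → suc (a + c) + (j + l) ≡ (a + suc j) + (c + l)
  regroup = solve-∀

first-row-hook⇒ : ∀ {x μ j t} → StrictPartition μ → j < x → hook (x ∷ μ) 0 j ≡ t →
  t ≤ x + length μ × x + length μ ∸ t ∉ β-set μ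
first-row-hook⇒ {x} {μ} {j} {t} sp j<x refl =
  subst (t ≤_) t+h≡ (m≤m+n t _) ,
  λ b∈ → hole∉β-set j μ sp (subst (_∈ β-set μ) (trans (cong (_∸ t) (sym t+h≡)) (m+n∸m≡n t _)) b∈)
  where
  t+h≡ : t + hole j μ ≡ x + length μ
  t+h≡ = hook₀+hole x μ j j<x

first-row-hook⇐ : ∀ {x μ t} → StrictPartition (x ∷ μ) → 1 ≤ t → t ≤ x + length μ →
  x + length μ ∸ t ∉ β-set μ → ∃ λ j → j < x × hook (x ∷ μ) 0 j ≡ t
first-row-hook⇐ {suc x} {μ} {t} (_ , μ<x , sp) 1≤t t≤B b∉ =
  let j , j≤x , hole≡ = hole-complete x μ sp (B ∸ t) B∸t≤last-hole b∉ in
  j , s≤s j≤x , (begin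
    hook (suc x ∷ μ) 0 j                        ≡⟨ m+n∸n≡m _ (hole j μ) ⟨
    hook (suc x ∷ μ) 0 j + hole j μ ∸ hole j μ  ≡⟨ cong₂ _∸_ (hook₀+hole (suc x) μ j (s≤s j≤x)) hole≡ ⟩
    B ∸ (B ∸ t)                                 ≡⟨ m∸[m∸n]≡n t≤B ⟩
    t                                           ∎)
  where
  open ≡-Reasoning
  B : ℕ
  B = suc x + length μ
  B∸t≤last-hole : B ∸ t ≤ hole x μ
  B∸t≤last-hole = ≤-trans (∸-monoʳ-≤ B 1≤t) (≤-reflexive (cong (x +_) (sym (count≤-all x μ (All.map ≤-pred μ<x)))))

SubtractionClosed : ℕ → List ℕ → Set
SubtractionClosed t []       = ⊤
SubtractionClosed t (b ∷ bs) = (t ≤ b → b ∸ t ∈ bs) × SubtractionClosed t bs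

SubtractionClosed-below : ∀ t w → All (_< t) w → SubtractionClosed t w
SubtractionClosed-below t []       []            = tt
SubtractionClosed-below t (b ∷ bs) (b<t ∷ bs<t) = (λ t≤b → ⊥-elim (<⇒≱ b<t t≤b)) , SubtractionClosed-below t bs bs<t

core⇒β-closed : ∀ {t} λ′ → StrictPartition λ′ → 1 ≤ t → IsCore t λ′ → SubtractionClosed t (β-set λ′)
core⇒β-closed []      _               _   _    = tt
core⇒β-closed {t} (x ∷ μ) sp@(_ , _ , sp′) 1≤t core =
  first-row , core⇒β-closed μ sp′ 1≤t (λ (i , j , cell) → core (suc i , j , cell))
  where
  first-row : t ≤ x + length μ → x + length μ ∸ t ∈ β-set μ
  first-row t≤B with x + length μ ∸ t ∈? β-set μ
  ... | yes b∈ = b∈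
  ... | no  b∉ with first-row-hook⇐ sp 1≤t t≤B b∉
  ...   | j , j<x , hook≡t = ⊥-elim (core (0 , j , j<x , hook≡t))

β-closed⇒core : ∀ {t} λ′ → StrictPartition λ′ → SubtractionClosed t (β-set λ′) → IsCore t λ′
β-closed⇒core []      _            _                (_ , _ , () , _)
β-closed⇒core (x ∷ μ) (_ , _ , sp) (first-row , _) (zero , j , j<x , hook≡t) =
  let t≤B , b∉ = first-row-hook⇒ sp j<x hook≡t in b∉ (first-row t≤B)
β-closed⇒core (x ∷ μ) (_ , _ , sp) (_ , closed) (suc i , j , cell) = β-closed⇒core μ sp closed (i , j , cell)

length-β-set : ∀ λ′ → length (β-set λ′) ≡ length λ′
length-β-set []      = refl
length-β-set (x ∷ μ) = cong suc (length-β-set μ)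

β-set⁻¹ : List ℕ → List ℕ
β-set⁻¹ []       = []
β-set⁻¹ (b ∷ bs) = b ∸ length bs ∷ β-set⁻¹ bs

length-β-set⁻¹ : ∀ bs → length (β-set⁻¹ bs) ≡ length bs
length-β-set⁻¹ []       = refl
length-β-set⁻¹ (b ∷ bs) = cong suc (length-β-set⁻¹ bs)

β-set⁻¹∘β-set : ∀ λ′ → β-set⁻¹ (β-set λ′) ≡ λ′
β-set⁻¹∘β-set []      = refl
β-set⁻¹∘β-set (x ∷ μ) =
  cong₂ _∷_ (trans (cong (x + length μ ∸_) (length-β-set μ)) (m+n∸n≡m x (length μ))) (β-set⁻¹∘β-set μ)

module _ (d : ℕ) where

  -- Consecutive entries of the β-set of a partition with d-distinct parts differ by more than d.
  infix 4 _≫_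
  _≫_ : ℕ → ℕ → Set
  b ≫ c = c + suc d ≤ b

  ≫-trans : Transitive _≫_
  ≫-trans {b} {c} b≫c c≫e = ≤-trans c≫e (≤-trans (m≤m+n c (suc d)) b≫c)

  Spaced : List ℕ → Set
  Spaced = Linked _≫_

  spaced⇒head≫ : ∀ {b} bs → Spaced (b ∷ bs) → All (b ≫_) bs
  spaced⇒head≫ []       _            = []
  spaced⇒head≫ (c ∷ cs) (b≫c ∷ spc) = Linked⇒All ≫-trans b≫c spc

  spaced⇒head≥ : ∀ {b} bs → Spaced (b ∷ bs) → All (_≤ b) bs
  spaced⇒head≥ bs sp = All.map (λ {c} → ≤-trans (m≤m+n c (suc d))) (spaced⇒head≫ bs sp)

  spaced⇒length<head : ∀ b bs → Spaced (b ∷ bs) → All (1 ≤_) (b ∷ bs) → length bs < b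
  spaced⇒length<head b []       _           (1≤b ∷ _)   = 1≤b
  spaced⇒length<head b (c ∷ cs) (b≫c ∷ spc) (_ ∷ pos) =
    ≤-trans (s≤s (spaced⇒length<head c cs spc pos)) (≤-trans (m<m+n c z<s) b≫c)

  DDistinct⇒decreasing : ∀ λ′ → DDistinct d λ′ → Linked (λ a b → b ≤ a) λ′
  DDistinct⇒decreasing []           _            = []
  DDistinct⇒decreasing (x ∷ [])     _            = [-]
  DDistinct⇒decreasing (x ∷ y ∷ ys) (y+d≤x , dd) = ≤-trans (m≤m+n y d) y+d≤x ∷ DDistinct⇒decreasing (y ∷ ys) dd

  DDistinct⇒StrictPartition : 1 ≤ d → ∀ λ′ → All (1 ≤_) λ′ → DDistinct d λ′ → StrictPartition λ′
  DDistinct⇒StrictPartition 1≤d []           _                _            = tt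
  DDistinct⇒StrictPartition 1≤d (x ∷ [])     (1≤x ∷ _)        _            = 1≤x , [] , tt
  DDistinct⇒StrictPartition 1≤d (x ∷ y ∷ ys) (1≤x ∷ pos) (y+d≤x , dd) =
    1≤x , y<x ∷ All.map (λ z<y → <-trans z<y y<x) ys<y , sp
    where
    sp : StrictPartition (y ∷ ys)
    sp = DDistinct⇒StrictPartition 1≤d (y ∷ ys) pos dd
    ys<y : All (_< y) ys
    ys<y = proj₁ (proj₂ sp)
    y<x : y < x
    y<x = ≤-trans (≤-reflexive (+-comm 1 y)) (≤-trans (+-monoʳ-≤ y 1≤d) y+d≤x)

  β-set-spaced : ∀ λ′ → DDistinct d λ′ → Spaced (β-set λ′)
  β-set-spaced []           _            = []
  β-set-spaced (x ∷ [])     _            = [-]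
  β-set-spaced (x ∷ y ∷ ys) (y+d≤x , dd) =
    ≤-trans (≤-reflexive (shuffle y (length ys) d)) (+-monoˡ-≤ (suc (length ys)) y+d≤x) ∷ β-set-spaced (y ∷ ys) dd
    where
    shuffle : ∀ y l d → y + l + suc d ≡ y + d + suc l
    shuffle = solve-∀

  β-set-positive : ∀ λ′ → All (1 ≤_) λ′ → All (1 ≤_) (β-set λ′)
  β-set-positive []      []          = []
  β-set-positive (x ∷ μ) (1≤x ∷ pos) = ≤-trans 1≤x (m≤m+n x _) ∷ β-set-positive μ pos

  β-set∘β-set⁻¹ : ∀ bs → Spaced bs → All (1 ≤_) bs → β-set (β-set⁻¹ bs) ≡ bs
  β-set∘β-set⁻¹ []       _  _           = refl
  β-set∘β-set⁻¹ (b ∷ bs) sp pos@(_ ∷ pos′) =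
    cong₂ _∷_ (trans (cong (b ∸ length bs +_) (length-β-set⁻¹ bs)) (m∸n+n≡m (<⇒≤ (spaced⇒length<head b bs sp pos))))
              (β-set∘β-set⁻¹ bs (Linked.tail sp) pos′)

  β-set⁻¹-DDistinct : ∀ bs → Spaced bs → All (1 ≤_) bs → DDistinct d (β-set⁻¹ bs)
  β-set⁻¹-DDistinct []           _            _             = tt
  β-set⁻¹-DDistinct (b ∷ [])     _            _             = tt
  β-set⁻¹-DDistinct (b ∷ c ∷ cs) (b≫c ∷ spc) (_ ∷ pos) = (begin
    c ∸ l + d         ≡⟨ +-∸-comm d l≤c ⟨
    c + d ∸ l         ≡⟨ cong (_∸ suc l) (+-suc c d) ⟨
    c + suc d ∸ suc l ≤⟨ ∸-monoˡ-≤ (suc l) b≫c ⟩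
    b ∸ suc l         ∎) , β-set⁻¹-DDistinct (c ∷ cs) spc pos
    where
    open ≤-Reasoning
    l : ℕ
    l = length cs
    l≤c : l ≤ c
    l≤c = <⇒≤ (spaced⇒length<head c cs spc pos)

  β-set⁻¹-positive : ∀ bs → Spaced bs → All (1 ≤_) bs → All (1 ≤_) (β-set⁻¹ bs)
  β-set⁻¹-positive []       _  _             = []
  β-set⁻¹-positive (b ∷ bs) sp pos@(_ ∷ pos′) =
    m<n⇒0<n∸m (spaced⇒length<head b bs sp pos) ∷ β-set⁻¹-positive bs (Linked.tail sp) pos′

  InRange : ℕ → ℕ → List ℕ → Set
  InRange lo hi w = Spaced w × All (lo ≤_) w × All (_≤ hi) w

  -- Spaced lists with entries in [lo, hi], for lo ≥ 1; the fuel only has to exceed hi.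
  spacedF : ℕ → ℕ → ℕ → List (List ℕ)
  spacedF zero    lo hi      = [ [] ]
  spacedF (suc f) lo zero    = [ [] ]
  spacedF (suc f) lo (suc h) with suc h <? lo
  ... | yes _ = [ [] ]
  ... | no  _ = spacedF f lo h ++ map (suc h ∷_) (spacedF f lo (h ∸ d))

  spacedBetween : ℕ → ℕ → List (List ℕ)
  spacedBetween lo hi = spacedF (suc hi) lo hi

  []∈spacedF : ∀ f lo hi → [] ∈ spacedF f lo hi
  []∈spacedF zero    lo hi      = here refl
  []∈spacedF (suc f) lo zero    = here refl
  []∈spacedF (suc f) lo (suc h) with suc h <? lo
  ... | yes _ = here refl
  ... | no  _ = ∈-++⁺ˡ ([]∈spacedF f lo h)

  spaced-∷ : ∀ b bs → All (b ≫_) bs → Spaced bs → Spaced (b ∷ bs)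
  spaced-∷ b []       _           _  = [-]
  spaced-∷ b (c ∷ cs) (b≫c ∷ _) sp = b≫c ∷ sp

  ≤∸⇒≫ : ∀ {h c} → 1 ≤ c → c ≤ h ∸ d → suc h ≫ c
  ≤∸⇒≫ {h} {c} 1≤c c≤h∸d = begin
    c + suc d      ≡⟨ +-suc c d ⟩
    suc (c + d)    ≤⟨ s≤s (+-monoˡ-≤ d c≤h∸d) ⟩
    suc (h ∸ d + d) ≡⟨ cong suc (m∸n+n≡m d≤h) ⟩
    suc h          ∎
    where
    open ≤-Reasoning
    d≤h : d ≤ h
    d≤h = ≮⇒≥ (λ h<d → <⇒≱ (≤-trans 1≤c (≤-trans c≤h∸d (≤-reflexive (m≤n⇒m∸n≡0 (<⇒≤ h<d))))) z≤n)

  spacedF-sound : ∀ f lo hi w → 1 ≤ lo → w ∈ spacedF f lo hi → InRange lo hi w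
  spacedF-sound zero    lo hi      .[] _ (here refl) = [] , [] , []
  spacedF-sound (suc f) lo zero    .[] _ (here refl) = [] , [] , []
  spacedF-sound (suc f) lo (suc h) w 1≤lo w∈ with suc h <? lo
  spacedF-sound (suc f) lo (suc h) .[] _ (here refl) | yes _ = [] , [] , []
  ... | no h≮lo with ∈-++⁻ (spacedF f lo h) w∈
  ...   | inj₁ w∈′ =
    let sp , lo≤ , ≤h = spacedF-sound f lo h w 1≤lo w∈′ in sp , lo≤ , All.map m≤n⇒m≤1+n ≤h
  ...   | inj₂ w∈′ with ∈-map⁻ (suc h ∷_) w∈′
  ...     | u , u∈ , refl =
    let sp , lo≤ , ≤h∸d = spacedF-sound f lo (h ∸ d) u 1≤lo u∈ in
    spaced-∷ (suc h) u (All.zipWith (λ (lo≤c , c≤) → ≤∸⇒≫ (≤-trans 1≤lo lo≤c) c≤) (lo≤ , ≤h∸d)) sp ,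
    ≮⇒≥ h≮lo ∷ lo≤ ,
    ≤-refl ∷ All.map (λ c≤ → m≤n⇒m≤1+n (≤-trans c≤ (m∸n≤m h d))) ≤h∸d

  spacedF-complete : ∀ f lo hi w → hi < f → 1 ≤ lo → InRange lo hi w → w ∈ spacedF f lo hi
  spacedF-complete (suc f) lo zero [] _ _ _ = here refl
  spacedF-complete (suc f) lo zero (b ∷ bs) _ 1≤lo (_ , lo≤b ∷ _ , b≤0 ∷ _) with ≤-trans (≤-trans 1≤lo lo≤b) b≤0
  ... | ()
  spacedF-complete (suc f) lo (suc h) w (s≤s h<f) 1≤lo inRange with suc h <? lo
  spacedF-complete (suc f) lo (suc h) [] _ _ _ | yes _ = here refl
  spacedF-complete (suc f) lo (suc h) (c ∷ cs) _ _ (_ , lo≤c ∷ _ , c≤ ∷ _) | yes h<lo =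
    ⊥-elim (<⇒≱ h<lo (≤-trans lo≤c c≤))
  spacedF-complete (suc f) lo (suc h) [] _ _ _ | no _ = ∈-++⁺ˡ ([]∈spacedF f lo h)
  spacedF-complete (suc f) lo (suc h) (c ∷ cs) (s≤s h<f) 1≤lo (sp , lo≤ , c≤ ∷ _) | no _ with c ≤? h
  ... | yes c≤h =
    ∈-++⁺ˡ (spacedF-complete f lo h (c ∷ cs) h<f 1≤lo
              (sp , lo≤ , c≤h ∷ All.map (λ e≤c → ≤-trans e≤c c≤h) (spaced⇒head≥ cs sp)))
  ... | no c≰h with ≤-antisym c≤ (≰⇒> c≰h)
  ...   | refl = ∈-++⁺ʳ (spacedF f lo h) (∈-map⁺ (suc h ∷_)
          (spacedF-complete f lo (h ∸ d) cs (≤-<-trans (m∸n≤m h d) h<f) 1≤lo (Linked.tail sp , All.tail lo≤ , cs≤)))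
    where
    cs≤ : All (_≤ h ∸ d) cs
    cs≤ = All.map (λ {e} c≫e → m+n≤o⇒m≤o∸n e (≤-pred (≤-trans (≤-reflexive (sym (+-suc e d))) c≫e)))
                  (spaced⇒head≫ cs sp)

  spacedF-unique : ∀ f lo hi → 1 ≤ lo → Unique (spacedF f lo hi)
  spacedF-unique zero    lo hi      _ = [] ∷ []
  spacedF-unique (suc f) lo zero    _ = [] ∷ []
  spacedF-unique (suc f) lo (suc h) 1≤lo with suc h <? lo
  ... | yes _ = [] ∷ []
  ... | no  _ = Unique.++⁺ (spacedF-unique f lo h 1≤lo) (Unique.map⁺ ∷-injectiveʳ (spacedF-unique f lo (h ∸ d) 1≤lo)) disjoint
    where
    disjoint : ∀ {v} → ¬ (v ∈ spacedF f lo h × v ∈ map (suc h ∷_) (spacedF f lo (h ∸ d)))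
    disjoint (v∈ , v∈′) with ∈-map⁻ (suc h ∷_) v∈′
    ... | u , _ , refl with spacedF-sound f lo h _ 1≤lo v∈
    ...   | _ , _ , (h+1≤h ∷ _) = 1+n≰n h+1≤h

  #spacedF : ℕ → ℕ → ℕ
  #spacedF zero    w       = 1
  #spacedF (suc f) zero    = 1
  #spacedF (suc f) (suc w) = #spacedF f w + #spacedF f (w ∸ d)

  #spacedF-fuel : ∀ f g w → w < f → w < g → #spacedF f w ≡ #spacedF g w
  #spacedF-fuel (suc f) (suc g) zero    _         _         = refl
  #spacedF-fuel (suc f) (suc g) (suc w) (s≤s w<f) (s≤s w<g) =
    cong₂ _+_ (#spacedF-fuel f g w w<f w<g)
              (#spacedF-fuel f g (w ∸ d) (≤-<-trans (m∸n≤m w d) w<f) (≤-<-trans (m∸n≤m w d) w<g))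

  -- The number of spaced lists with entries in an interval of length w.
  #spaced : ℕ → ℕ
  #spaced w = #spacedF (suc w) w

  #spaced-suc : ∀ w → #spaced (suc w) ≡ #spaced w + #spaced (w ∸ d)
  #spaced-suc w = cong (#spaced w +_) (#spacedF-fuel (suc w) (suc (w ∸ d)) (w ∸ d) (s≤s (m∸n≤m w d)) ≤-refl)

  length-spacedF : ∀ f lo hi → hi < f → 1 ≤ lo → length (spacedF f lo hi) ≡ #spaced (suc hi ∸ lo)
  length-spacedF (suc f) (suc l) zero    _         _ = cong #spaced (sym (0∸n≡0 l))
  length-spacedF (suc f) (suc l) (suc h) (s≤s h<f) 1≤lo with suc h <? suc l
  ... | yes h<l = cong #spaced (sym (m≤n⇒m∸n≡0 h<l))
  ... | no  h≮l = begin
    length (spacedF f (suc l) h ++ map (suc h ∷_) (spacedF f (suc l) (h ∸ d)))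
      ≡⟨ length-++ (spacedF f (suc l) h) ⟩
    length (spacedF f (suc l) h) + length (map (suc h ∷_) (spacedF f (suc l) (h ∸ d)))
      ≡⟨ cong (length (spacedF f (suc l) h) +_) (length-map (suc h ∷_) (spacedF f (suc l) (h ∸ d))) ⟩
    length (spacedF f (suc l) h) + length (spacedF f (suc l) (h ∸ d))
      ≡⟨ cong₂ _+_ (length-spacedF f (suc l) h h<f 1≤lo)
                   (length-spacedF f (suc l) (h ∸ d) (≤-<-trans (m∸n≤m h d) h<f) 1≤lo) ⟩
    #spaced (h ∸ l) + #spaced (h ∸ d ∸ l)
      ≡⟨ cong (λ w → #spaced (h ∸ l) + #spaced w) (∸-∸-comm h d l) ⟩
    #spaced (h ∸ l) + #spaced (h ∸ l ∸ d)
      ≡⟨ #spaced-suc (h ∸ l) ⟨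
    #spaced (suc (h ∸ l))
      ≡⟨ cong #spaced (+-∸-assoc 1 (≤-pred (≮⇒≥ h≮l))) ⟨
    #spaced (suc h ∸ l) ∎
    where open ≡-Reasoning

  spacedBetween-sound : ∀ {lo hi w} → 1 ≤ lo → w ∈ spacedBetween lo hi → InRange lo hi w
  spacedBetween-sound {lo} {hi} {w} = spacedF-sound (suc hi) lo hi w

  spacedBetween-complete : ∀ {lo hi w} → 1 ≤ lo → InRange lo hi w → w ∈ spacedBetween lo hi
  spacedBetween-complete {lo} {hi} {w} = spacedF-complete (suc hi) lo hi w ≤-refl

  spacedBetween-unique : ∀ lo hi → 1 ≤ lo → Unique (spacedBetween lo hi)
  spacedBetween-unique lo hi = spacedF-unique (suc hi) lo hi

  length-spacedBetween : ∀ lo hi → 1 ≤ lo → length (spacedBetween lo hi) ≡ #spaced (suc hi ∸ lo)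
  length-spacedBetween lo hi = length-spacedF (suc hi) lo hi ≤-refl

  spaced-∷ʳ : ∀ u m → Spaced u → All (_≫ m) u → Spaced (u ++ [ m ])
  spaced-∷ʳ []           m _            _                 = [-]
  spaced-∷ʳ (c ∷ [])     m _            (c≫m ∷ [])       = c≫m ∷ [-]
  spaced-∷ʳ (c ∷ e ∷ es) m (c≫e ∷ spe) (_ ∷ es≫m) = c≫e ∷ spaced-∷ʳ (e ∷ es) m spe es≫m

  spaced-++⁻ˡ : ∀ xs ys → Spaced (xs ++ ys) → Spaced xs
  spaced-++⁻ˡ []           ys _            = []
  spaced-++⁻ˡ (x ∷ [])     ys _            = [-]
  spaced-++⁻ˡ (x ∷ y ∷ zs) ys (x≫y ∷ sp) = x≫y ∷ spaced-++⁻ˡ (y ∷ zs) ys sp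

  spaced-distance : ∀ {k} l u → 1 ≤ k → k ≤ d → Spaced l → u ∈ l → u + k ∈ l → ⊥
  spaced-distance (c ∷ cs) u 1≤k k≤d sp (here refl) (here u+k≡u) = <⇒≢ (m<m+n u 1≤k) (sym u+k≡u)
  spaced-distance {k} (c ∷ cs) u 1≤k k≤d sp (here refl) (there u+k∈) =
    1+n≰n (≤-trans (s≤s (m≤m+n u k)) (≤-trans (m<m+n (u + k) z<s) (All.lookup (spaced⇒head≫ cs sp) u+k∈)))
  spaced-distance (c ∷ cs) u 1≤k k≤d sp (there u∈) (here refl) =
    1+n≰n (≤-trans (≤-reflexive (sym (+-suc u d))) (≤-trans (All.lookup (spaced⇒head≫ cs sp) u∈) (+-monoʳ-≤ u k≤d)))
  spaced-distance (c ∷ cs) u 1≤k k≤d sp (there u∈) (there u+k∈) = spaced-distance cs u 1≤k k≤d (Linked.tail sp) u∈ u+k∈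

  spaced-small-last : ∀ m bs → Spaced bs → All (1 ≤_) bs → m ∈ bs → m ≤ d →
    ∃ λ u → bs ≡ u ++ [ m ] × Spaced u × All (_≫ m) u
  spaced-small-last m (c ∷ [])     _           _                 (here refl) m≤d = [] , refl , [] , []
  spaced-small-last m (c ∷ e ∷ es) (c≫e ∷ _) (_ ∷ 1≤e ∷ _)     (here refl) m≤d =
    ⊥-elim (1+n≰n (≤-trans (n≤1+n _) (≤-trans (≤-trans (+-monoˡ-≤ (suc d) 1≤e) c≫e) m≤d)))
  spaced-small-last m (c ∷ cs)     sp          (_ ∷ pos)         (there m∈)  m≤d
    with spaced-small-last m cs (Linked.tail sp) pos m∈ m≤d
  ... | u , refl , _ , u≫m =
    c ∷ u , refl , spaced-++⁻ˡ (c ∷ u) [ m ] sp ,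
    All.lookup (spaced⇒head≫ (u ++ [ m ]) sp) (∈-++⁺ʳ u (here refl)) ∷ u≫m

  -- The number of lists s + m ∷ u ++ [ m ] with u spaced in [m+d+1, s+m-d-1], whatever m is.
  #extremal : ℕ → ℕ
  #extremal s with d <? s
  ... | yes _ = #spaced (s ∸ suc d ∸ d)
  ... | no  _ = 0

  #extremal-≤ : ∀ s → s ≤ d → #extremal s ≡ 0
  #extremal-≤ s s≤d with d <? s
  ... | yes d<s = ⊥-elim (<⇒≱ d<s s≤d)
  ... | no  _   = refl

  #extremal-> : ∀ s → d < s → #extremal s ≡ #spaced (s ∸ suc d ∸ d)
  #extremal-> s d<s with d <? s
  ... | yes _   = refl
  ... | no  d≮s = ⊥-elim (d≮s d<s)

  #extremal-suc-d : #extremal (suc d) ≡ 1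
  #extremal-suc-d = trans (#extremal-> (suc d) ≤-refl) (cong #spaced (trans (cong (_∸ d) (n∸n≡0 d)) (0∸n≡0 d)))

  #extremal-offset : ∀ u → #extremal (suc d + u) ≡ #spaced (u ∸ d)
  #extremal-offset u = trans (#extremal-> (suc d + u) (s≤s (m≤m+n d u))) (cong (λ v → #spaced (v ∸ d)) (m+n∸m≡n (suc d) u))

  #spaced-small : ∀ k → k ≤ d → #spaced (suc k) ≡ #spaced k + 1
  #spaced-small k k≤d = trans (#spaced-suc k) (cong (λ v → #spaced k + #spaced v) (m≤n⇒m∸n≡0 k≤d))

  #spaced-suc-∸ : ∀ t → #spaced (suc t ∸ d) ≡ #spaced (t ∸ d) + #extremal (suc t)
  #spaced-suc-∸ t with d ≤? t
  ... | yes d≤t = begin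
    #spaced (suc t ∸ d)                     ≡⟨ cong #spaced (+-∸-assoc 1 d≤t) ⟩
    #spaced (suc (t ∸ d))                   ≡⟨ #spaced-suc (t ∸ d) ⟩
    #spaced (t ∸ d) + #spaced (t ∸ d ∸ d)   ≡⟨ cong (#spaced (t ∸ d) +_) (#extremal-> (suc t) (s≤s d≤t)) ⟨
    #spaced (t ∸ d) + #extremal (suc t)     ∎
    where open ≡-Reasoning
  ... | no  d≰t = begin
    #spaced (suc t ∸ d)                     ≡⟨ cong #spaced (m≤n⇒m∸n≡0 t<d) ⟩
    #spaced 0                               ≡⟨ +-identityʳ _ ⟨
    #spaced 0 + 0
      ≡⟨ cong₂ (λ u v → #spaced u + v) (m≤n⇒m∸n≡0 (<⇒≤ t<d)) (#extremal-≤ (suc t) t<d) ⟨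
    #spaced (t ∸ d) + #extremal (suc t)     ∎
    where
    open ≡-Reasoning
    t<d : t < d
    t<d = ≰⇒> d≰t

  module _ (r : ℕ) where

    CoreSet : ℕ → List ℕ → Set
    CoreSet s w = Spaced w × All (1 ≤_) w × SubtractionClosed s w × SubtractionClosed (s + r) w

    -- The core sets whose largest entry s + m is at least s; they end in m.
    extremal : ℕ → ℕ → List (List ℕ)
    extremal s m with d <? s
    ... | yes _ = map (λ u → s + m ∷ u ++ [ m ]) (spacedBetween (m + suc d) (s + m ∸ suc d))
    ... | no  _ = []

    extremals : ℕ → ℕ → List (List ℕ)
    extremals s zero    = []
    extremals s (suc k) = extremals s k ++ extremal s (suc k)

    coreSets : ℕ → List (List ℕ)
    coreSets s = spacedBetween 1 (s ∸ 1) ++ extremals s (r ∸ 1)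

    extremal-CoreSet : ∀ s m u → d < s → 1 ≤ m → m < r → r ≤ d →
      InRange (m + suc d) (s + m ∸ suc d) u → CoreSet s (s + m ∷ u ++ [ m ])
    extremal-CoreSet s m u d<s 1≤m m<r r≤d (spu , lo≤u , u≤hi) =
      spaced-∷ (s + m) (u ++ [ m ]) below-head (spaced-∷ʳ u m spu lo≤u) ,
      ≤-trans 1≤m (m≤n+m m s) ∷ AllP.++⁺ (All.map (≤-trans (≤-trans 1≤m (m≤m+n m (suc d)))) lo≤u) (1≤m ∷ []) ,
      ((λ _ → subst (_∈ u ++ [ m ]) (sym (m+n∸m≡n s m)) (∈-++⁺ʳ u (here refl))) , SubtractionClosed-below s _ tail<s) ,
      ((λ s+r≤s+m → ⊥-elim (<⇒≱ m<r (+-cancelˡ-≤ s r m s+r≤s+m))) ,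
       SubtractionClosed-below (s + r) _ (All.map (λ c<s → <-≤-trans c<s (m≤m+n s r)) tail<s))
      where
      d<s+m : suc d ≤ s + m
      d<s+m = ≤-trans d<s (m≤m+n s m)
      below-head : All (s + m ≫_) (u ++ [ m ])
      below-head = AllP.++⁺ (All.map (λ {c} c≤ → ≤-trans (+-monoˡ-≤ (suc d) c≤) (≤-reflexive (m∸n+n≡m d<s+m))) u≤hi)
                            (≤-trans (+-monoʳ-≤ m d<s) (≤-reflexive (+-comm m s)) ∷ [])
      m≤d : m ≤ d
      m≤d = ≤-trans (n≤1+n m) (≤-trans m<r r≤d)
      tail<s : All (_< s) (u ++ [ m ])
      tail<s = All.map (λ {c} c≫ → +-cancelʳ-≤ d (suc c) s
                 (≤-trans (≤-reflexive (sym (+-suc c d))) (≤-trans c≫ (+-monoʳ-≤ s m≤d))))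
               below-head

    extremal-sound : ∀ s m v → 1 ≤ m → m < r → r ≤ d → v ∈ extremal s m → CoreSet s v
    extremal-sound s m v 1≤m m<r r≤d v∈ with d <? s
    extremal-sound s m v 1≤m m<r r≤d () | no _
    ... | yes d<s with ∈-map⁻ (λ u → s + m ∷ u ++ [ m ]) v∈
    ...   | u , u∈ , refl =
      extremal-CoreSet s m u d<s 1≤m m<r r≤d (spacedBetween-sound (≤-trans 1≤m (m≤m+n m (suc d))) u∈)

    extremals-sound : ∀ s k v → k < r → r ≤ d → v ∈ extremals s k → CoreSet s v
    extremals-sound s (suc k) v k<r r≤d v∈ with ∈-++⁻ (extremals s k) v∈
    ... | inj₁ v∈′ = extremals-sound s k v (<-trans (n<1+n k) k<r) r≤d v∈′
    ... | inj₂ v∈′ = extremal-sound s (suc k) v (s≤s z≤n) k<r r≤d v∈′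

    coreSets-sound : ∀ s v → 1 ≤ s → 1 ≤ r → r ≤ d → v ∈ coreSets s → CoreSet s v
    coreSets-sound (suc s) v _ 1≤r r≤d v∈ with ∈-++⁻ (spacedBetween 1 s) v∈
    ... | inj₂ v∈′ = extremals-sound (suc s) (r ∸ 1) v (∸-monoʳ-< {r} z<s 1≤r) r≤d v∈′
    ... | inj₁ v∈′ =
      let spv , pos , v≤s = spacedBetween-sound ≤-refl v∈′ in
      spv , pos , SubtractionClosed-below (suc s) v (All.map s≤s v≤s) ,
      SubtractionClosed-below (suc s + r) v (All.map (λ c≤s → ≤-trans (s≤s c≤s) (m≤m+n (suc s) r)) v≤s)

    head<s+r : ∀ s B bs → 1 ≤ r → r ≤ d → s ≤ B → CoreSet s (B ∷ bs) → B < s + r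
    head<s+r s B bs 1≤r r≤d s≤B (sp , _ , (s-closed , _) , (s+r-closed , _)) with s + r ≤? B
    ... | no  s+r≰B = ≰⇒> s+r≰B
    ... | yes s+r≤B =
      ⊥-elim (spaced-distance bs (B ∸ (s + r)) 1≤r r≤d (Linked.tail sp) (s+r-closed s+r≤B)
                (subst (_∈ bs) (sym B∸[s+r]+r≡B∸s) (s-closed s≤B)))
      where
      B∸[s+r]+r≡B∸s : B ∸ (s + r) + r ≡ B ∸ s
      B∸[s+r]+r≡B∸s = trans (cong (_+ r) (sym (∸-+-assoc B s r)))
                            (m∸n+n≡m (m+n≤o⇒m≤o∸n r (≤-trans (≤-reflexive (+-comm r s)) s+r≤B)))

    offset∈ : ∀ s m bs → CoreSet s (s + m ∷ bs) → m ∈ bs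
    offset∈ s m bs (_ , _ , (s-closed , _) , _) = subst (_∈ bs) (m+n∸m≡n s m) (s-closed (m≤m+n s m))

    offset<r : ∀ s m bs → 1 ≤ r → r ≤ d → CoreSet s (s + m ∷ bs) → m < r
    offset<r s m bs 1≤r r≤d core =
      +-cancelˡ-≤ s (suc m) r (≤-trans (≤-reflexive (+-suc s m)) (head<s+r s (s + m) bs 1≤r r≤d (m≤m+n s m) core))

    extremal-complete : ∀ s m bs → 1 ≤ r → r ≤ d → CoreSet s (s + m ∷ bs) → (s + m ∷ bs) ∈ extremal s m
    extremal-complete s m bs 1≤r r≤d core@(sp , _ ∷ pos , _) with d <? s
    ... | no d≮s = ⊥-elim (d≮s (+-cancelˡ-≤ m (suc d) s
                     (≤-trans (All.lookup (spaced⇒head≫ bs sp) (offset∈ s m bs core)) (≤-reflexive (+-comm s m)))))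
    ... | yes _ with spaced-small-last m bs (Linked.tail sp) pos (offset∈ s m bs core)
                       (≤-trans (n≤1+n m) (≤-trans (offset<r s m bs 1≤r r≤d core) r≤d))
    ...   | u , refl , spu , u≫m = ∈-map⁺ (λ u → s + m ∷ u ++ [ m ])
              (spacedBetween-complete
                 (≤-trans (All.lookup pos (∈-++⁺ʳ u (here refl))) (m≤m+n m (suc d)))
                 (spu , u≫m , All.map (λ {c} → m+n≤o⇒m≤o∸n c) (AllP.++⁻ˡ u (spaced⇒head≫ (u ++ [ m ]) sp))))

    extremals-complete : ∀ s m k v → 1 ≤ m → m ≤ k → v ∈ extremal s m → v ∈ extremals s k
    extremals-complete s (suc _) zero    _ _   ()  _
    extremals-complete s m       (suc k) v 1≤m m≤k v∈ with m ≟ suc k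
    ... | yes refl = ∈-++⁺ʳ (extremals s k) v∈
    ... | no  m≢   = ∈-++⁺ˡ (extremals-complete s m k v 1≤m (≤-pred (≤∧≢⇒< m≤k m≢)) v∈)

    coreSets-complete : ∀ s w → 1 ≤ s → 1 ≤ r → r ≤ d → CoreSet s w → w ∈ coreSets s
    coreSets-complete (suc s) []       _ _   _   _                = ∈-++⁺ˡ ([]∈spacedF (suc s) 1 s)
    coreSets-complete (suc s) (B ∷ bs) _ 1≤r r≤d core@(sp , pos , _) with B ≤? s
    ... | yes B≤s = ∈-++⁺ˡ (spacedBetween-complete ≤-refl
                      (sp , pos , B≤s ∷ All.map (λ c≤B → ≤-trans c≤B B≤s) (spaced⇒head≥ bs sp)))
    ... | no  B≰s = subst (λ B → B ∷ bs ∈ coreSets (suc s)) (m+[n∸m]≡n s<B)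
                      (∈-++⁺ʳ (spacedBetween 1 s) (largest-complete (B ∸ suc s) core′))
      where
      s<B : suc s ≤ B
      s<B = ≰⇒> B≰s
      core′ : CoreSet (suc s) (suc s + (B ∸ suc s) ∷ bs)
      core′ = subst (λ B → CoreSet (suc s) (B ∷ bs)) (sym (m+[n∸m]≡n s<B)) core
      largest-complete : ∀ m → CoreSet (suc s) (suc s + m ∷ bs) → suc s + m ∷ bs ∈ extremals (suc s) (r ∸ 1)
      largest-complete m core = extremals-complete (suc s) m (r ∸ 1) _
        (All.lookup (All.tail (proj₁ (proj₂ core))) (offset∈ (suc s) m bs core))
        (<⇒≤pred (offset<r (suc s) m bs 1≤r r≤d core))
        (extremal-complete (suc s) m bs 1≤r r≤d core)

    extremal-head : ∀ s m v → v ∈ extremal s m → ∃ λ t → v ≡ s + m ∷ t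
    extremal-head s m v v∈ with d <? s
    extremal-head s m v () | no _
    ... | yes _ with ∈-map⁻ (λ u → s + m ∷ u ++ [ m ]) v∈
    ...   | u , _ , refl = u ++ [ m ] , refl

    extremals-head : ∀ s k v → v ∈ extremals s k → ∃ λ m → m ≤ k × ∃ λ t → v ≡ s + m ∷ t
    extremals-head s (suc k) v v∈ with ∈-++⁻ (extremals s k) v∈
    ... | inj₁ v∈′ = let m , m≤k , rest = extremals-head s k v v∈′ in m , m≤n⇒m≤1+n m≤k , rest
    ... | inj₂ v∈′ = suc k , ≤-refl , extremal-head s (suc k) v v∈′

    extremal-unique : ∀ s m → Unique (extremal s m)
    extremal-unique s m with d <? s
    ... | no  _ = []
    ... | yes _ = Unique.map⁺ (λ {u} {u′} eq → proj₁ (∷ʳ-injective u u′ (∷-injectiveʳ eq)))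
                    (spacedBetween-unique (m + suc d) (s + m ∸ suc d) (≤-trans (s≤s z≤n) (m≤n+m (suc d) m)))

    extremals-unique : ∀ s k → Unique (extremals s k)
    extremals-unique s zero    = []
    extremals-unique s (suc k) = Unique.++⁺ (extremals-unique s k) (extremal-unique s (suc k)) disjoint
      where
      disjoint : ∀ {v} → ¬ (v ∈ extremals s k × v ∈ extremal s (suc k))
      disjoint {v} (v∈ , v∈′) with extremals-head s k v v∈ | extremal-head s (suc k) v v∈′
      ... | m , m≤k , _ , refl | _ , eq =
        1+n≰n (≤-trans (≤-reflexive (+-cancelˡ-≡ s (suc k) m (sym (proj₁ (∷-injective eq))))) m≤k)

    coreSets-unique : ∀ s → Unique (coreSets (suc s))
    coreSets-unique s = Unique.++⁺ (spacedBetween-unique 1 s ≤-refl) (extremals-unique (suc s) (r ∸ 1)) disjoint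
      where
      disjoint : ∀ {v} → ¬ (v ∈ spacedBetween 1 s × v ∈ extremals (suc s) (r ∸ 1))
      disjoint {v} (v∈ , v∈′) with extremals-head (suc s) (r ∸ 1) v v∈′
      ... | m , _ , _ , refl with spacedBetween-sound ≤-refl v∈
      ...   | _ , _ , (head≤s ∷ _) = 1+n≰n (≤-trans (s≤s (m≤m+n s m)) head≤s)

    length-extremal : ∀ s m → length (extremal s m) ≡ #extremal s
    length-extremal s m with d <? s
    ... | no  _   = refl
    ... | yes d<s = begin
      length (map (λ u → s + m ∷ u ++ [ m ]) (spacedBetween (m + suc d) (s + m ∸ suc d)))
        ≡⟨ length-map _ (spacedBetween (m + suc d) (s + m ∸ suc d)) ⟩
      length (spacedBetween (m + suc d) (s + m ∸ suc d))
        ≡⟨ length-spacedBetween (m + suc d) (s + m ∸ suc d) (≤-trans (s≤s z≤n) (m≤n+m (suc d) m)) ⟩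
      #spaced (suc (s + m ∸ suc d) ∸ (m + suc d))
        ≡⟨ cong #spaced width ⟩
      #spaced (s ∸ suc d ∸ d) ∎
      where
      open ≡-Reasoning
      width : suc (s + m ∸ suc d) ∸ (m + suc d) ≡ s ∸ suc d ∸ d
      width = begin
        suc (s + m ∸ suc d) ∸ (m + suc d) ≡⟨ cong (λ z → suc z ∸ (m + suc d)) (+-∸-comm m d<s) ⟩
        suc (s ∸ suc d + m) ∸ (m + suc d) ≡⟨ cong (suc (s ∸ suc d + m) ∸_) (+-suc m d) ⟩
        s ∸ suc d + m ∸ (m + d)           ≡⟨ cong (_∸ (m + d)) (+-comm (s ∸ suc d) m) ⟩
        m + (s ∸ suc d) ∸ (m + d)         ≡⟨ [m+n]∸[m+o]≡n∸o m (s ∸ suc d) d ⟩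
        s ∸ suc d ∸ d                     ∎

    length-extremals : ∀ s k → length (extremals s k) ≡ k * #extremal s
    length-extremals s zero    = refl
    length-extremals s (suc k) = begin
      length (extremals s k ++ extremal s (suc k))          ≡⟨ length-++ (extremals s k) ⟩
      length (extremals s k) + length (extremal s (suc k))  ≡⟨ cong₂ _+_ (length-extremals s k) (length-extremal s (suc k)) ⟩
      k * #extremal s + #extremal s                         ≡⟨ +-comm (k * #extremal s) _ ⟩
      suc k * #extremal s                                   ∎
      where open ≡-Reasoning

    length-coreSets : ∀ s → length (coreSets (suc s)) ≡ #spaced s + (r ∸ 1) * #extremal (suc s)
    length-coreSets s = trans (length-++ (spacedBetween 1 s))
      (cong₂ _+_ (length-spacedBetween 1 s ≤-refl) (length-extremals (suc s) (r ∸ 1)))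

    CoreDD⇒CoreSet : 1 ≤ d → ∀ s λ′ → 1 ≤ s → CoreDD d r s λ′ → CoreSet s (β-set λ′)
    CoreDD⇒CoreSet 1≤d s λ′ 1≤s ((_ , pos) , s-core , s+r-core , dd) =
      β-set-spaced λ′ dd , β-set-positive λ′ pos ,
      core⇒β-closed λ′ sp 1≤s s-core , core⇒β-closed λ′ sp (≤-trans 1≤s (m≤m+n s r)) s+r-core
      where
      sp : StrictPartition λ′
      sp = DDistinct⇒StrictPartition 1≤d λ′ pos dd

    CoreSet⇒CoreDD : 1 ≤ d → ∀ s w → CoreSet s w → CoreDD d r s (β-set⁻¹ w)
    CoreSet⇒CoreDD 1≤d s w (spw , pos , s-closed , s+r-closed) =
      (DDistinct⇒decreasing (β-set⁻¹ w) dd , pos′) ,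
      β-closed⇒core (β-set⁻¹ w) sp (subst (SubtractionClosed s) (sym β∘β⁻¹) s-closed) ,
      β-closed⇒core (β-set⁻¹ w) sp (subst (SubtractionClosed (s + r)) (sym β∘β⁻¹) s+r-closed) ,
      dd
      where
      dd : DDistinct d (β-set⁻¹ w)
      dd = β-set⁻¹-DDistinct w spw pos
      pos′ : All (1 ≤_) (β-set⁻¹ w)
      pos′ = β-set⁻¹-positive w spw pos
      sp : StrictPartition (β-set⁻¹ w)
      sp = DDistinct⇒StrictPartition 1≤d (β-set⁻¹ w) pos′ dd
      β∘β⁻¹ : β-set (β-set⁻¹ w) ≡ w
      β∘β⁻¹ = β-set∘β-set⁻¹ w spw pos

    #cores : ℕ → ℕ
    #cores zero    = 0
    #cores (suc s) = #spaced s + (r ∸ 1) * #extremal (suc s)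

    count-cores : 1 ≤ r → r ≤ d → ∀ s → 1 ≤ s → HasCount (CoreDD d r s) (#cores s)
    count-cores 1≤r r≤d (suc s) 1≤s =
      map β-set⁻¹ ws , unique , (λ λ′ → mk⇔ (sound λ′) (complete λ′)) ,
      trans (length-map β-set⁻¹ ws) (length-coreSets s)
      where
      ws : List (List ℕ)
      ws = coreSets (suc s)
      1≤d : 1 ≤ d
      1≤d = ≤-trans 1≤r r≤d
      ws-core : All (CoreSet (suc s)) ws
      ws-core = All.tabulate (coreSets-sound (suc s) _ 1≤s 1≤r r≤d)
      unique : Unique (map β-set⁻¹ ws)
      unique = Unique.map⁻ {f = β-set} (subst Unique (sym β∘β⁻¹-on-ws) (coreSets-unique s))
        where
        β∘β⁻¹-on-ws : map β-set (map β-set⁻¹ ws) ≡ ws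
        β∘β⁻¹-on-ws = trans (sym (map-∘ ws))
          (map-id-local (All.map (λ (spw , pos , _) → β-set∘β-set⁻¹ _ spw pos) ws-core))
      sound : ∀ λ′ → λ′ ∈ map β-set⁻¹ ws → CoreDD d r (suc s) λ′
      sound λ′ λ′∈ with ∈-map⁻ β-set⁻¹ λ′∈
      ... | w , w∈ , refl = CoreSet⇒CoreDD 1≤d (suc s) w (All.lookup ws-core w∈)
      complete : ∀ λ′ → CoreDD d r (suc s) λ′ → λ′ ∈ map β-set⁻¹ ws
      complete λ′ core = subst (_∈ map β-set⁻¹ ws) (β-set⁻¹∘β-set λ′)
        (∈-map⁺ β-set⁻¹ (coreSets-complete (suc s) (β-set λ′) 1≤s 1≤r r≤d
                          (CoreDD⇒CoreSet 1≤d (suc s) λ′ 1≤s core)))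

    #cores-small : ∀ k → suc k ≤ d → #cores (suc k) ≡ #spaced k
    #cores-small k k<d = begin
      #spaced k + (r ∸ 1) * #extremal (suc k)  ≡⟨ cong (λ e → #spaced k + (r ∸ 1) * e) (#extremal-≤ (suc k) k<d) ⟩
      #spaced k + (r ∸ 1) * 0                  ≡⟨ cong (#spaced k +_) (*-zeroʳ (r ∸ 1)) ⟩
      #spaced k + 0                            ≡⟨ +-identityʳ _ ⟩
      #spaced k                                ∎
      where open ≡-Reasoning

    #cores-below-d : 1 ≤ d → ∀ k → k < d → #cores (suc k) ≡ #cores k + 1
    #cores-below-d 1≤d zero    _   = #cores-small 0 1≤d
    #cores-below-d 1≤d (suc k) k<d = begin
      #cores (suc (suc k))  ≡⟨ #cores-small (suc k) k<d ⟩
      #spaced (suc k)       ≡⟨ #spaced-small k (≤-trans (n≤1+n k) (<⇒≤ k<d)) ⟩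
      #spaced k + 1         ≡⟨ cong (_+ 1) (#cores-small k (<⇒≤ k<d)) ⟨
      #cores (suc k) + 1    ∎
      where open ≡-Reasoning

    #cores-at-d : 1 ≤ r → 1 ≤ d → #cores (suc d) ≡ #cores d + r
    #cores-at-d 1≤r 1≤d = begin
      #spaced d + (r ∸ 1) * #extremal (suc d)  ≡⟨ cong (λ e → #spaced d + (r ∸ 1) * e) #extremal-suc-d ⟩
      #spaced d + (r ∸ 1) * 1                  ≡⟨ cong (#spaced d +_) (*-identityʳ (r ∸ 1)) ⟩
      #spaced d + (r ∸ 1)                      ≡⟨ cong (λ a → #spaced a + (r ∸ 1)) d′+1≡d ⟨
      #spaced (suc d′) + (r ∸ 1)               ≡⟨ cong (_+ (r ∸ 1)) (#spaced-small d′ (m∸n≤m d 1)) ⟩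
      #spaced d′ + 1 + (r ∸ 1)                 ≡⟨ +-assoc (#spaced d′) 1 (r ∸ 1) ⟩
      #spaced d′ + (1 + (r ∸ 1))               ≡⟨ cong (#spaced d′ +_) (m+[n∸m]≡n 1≤r) ⟩
      #spaced d′ + r                           ≡⟨ cong (_+ r) (#cores-small d′ (≤-reflexive d′+1≡d)) ⟨
      #cores (suc d′) + r                      ≡⟨ cong (λ a → #cores a + r) d′+1≡d ⟩
      #cores d + r                             ∎
      where
      open ≡-Reasoning
      d′ : ℕ
      d′ = d ∸ 1
      d′+1≡d : suc d′ ≡ d
      d′+1≡d = m+[n∸m]≡n 1≤d

    #cores-above-d : ∀ t → #cores (suc (suc d + t)) ≡ #cores (suc d + t) + #cores (suc t)
    #cores-above-d t = begin
      #spaced (suc d + t) + R * #extremal (suc (suc d + t))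
        ≡⟨ cong₂ (λ a e → a + R * e) (#spaced-suc (d + t)) (cong #extremal (sym (+-suc (suc d) t))) ⟩
      #spaced (d + t) + #spaced (d + t ∸ d) + R * #extremal (suc d + suc t)
        ≡⟨ cong₂ (λ a e → #spaced (d + t) + #spaced a + R * e) (m+n∸m≡n d t) (#extremal-offset (suc t)) ⟩
      #spaced (d + t) + #spaced t + R * #spaced (suc t ∸ d)
        ≡⟨ cong (λ a → #spaced (d + t) + #spaced t + R * a) (#spaced-suc-∸ t) ⟩
      #spaced (d + t) + #spaced t + R * (#spaced (t ∸ d) + #extremal (suc t))
        ≡⟨ regroup (#spaced (d + t)) (#spaced t) R (#spaced (t ∸ d)) (#extremal (suc t)) ⟩
      #spaced (d + t) + R * #spaced (t ∸ d) + (#spaced t + R * #extremal (suc t))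
        ≡⟨ cong (λ e → #spaced (d + t) + R * e + #cores (suc t)) (#extremal-offset t) ⟨
      #cores (suc d + t) + #cores (suc t) ∎
      where
      open ≡-Reasoning
      R : ℕ
      R = r ∸ 1
      regroup : ∀ a b R x e → a + b + R * (x + e) ≡ a + R * x + (b + R * e)
      regroup = solve-∀

    #cores-∸d : ∀ {k} → k ≤ d → #cores k ≡ #cores k + #cores (k ∸ d)
    #cores-∸d {k} k≤d = sym (trans (cong (λ z → #cores k + #cores z) (m≤n⇒m∸n≡0 k≤d)) (+-identityʳ (#cores k)))

    excess : ℕ → ℕ
    excess k with <-cmp k d
    ... | tri< _ _ _ = 1
    ... | tri≈ _ _ _ = r
    ... | tri> _ _ _ = 0

    excess-< : ∀ {k} → k < d → excess k ≡ 1
    excess-< {k} k<d with <-cmp k d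
    ... | tri< _ _ _    = refl
    ... | tri≈ k≮d _ _  = ⊥-elim (k≮d k<d)
    ... | tri> k≮d _ _  = ⊥-elim (k≮d k<d)

    excess-≡ : excess d ≡ r
    excess-≡ with <-cmp d d
    ... | tri< _ d≢d _ = ⊥-elim (d≢d refl)
    ... | tri≈ _ _ _   = refl
    ... | tri> _ d≢d _ = ⊥-elim (d≢d refl)

    excess-> : ∀ {k} → d < k → excess k ≡ 0
    excess-> {k} d<k with <-cmp k d
    ... | tri< _ _ k≯d  = ⊥-elim (k≯d d<k)
    ... | tri≈ _ _ k≯d  = ⊥-elim (k≯d d<k)
    ... | tri> _ _ _    = refl

    #cores-suc : 1 ≤ r → 1 ≤ d → ∀ k → #cores (suc k) ≡ #cores k + #cores (k ∸ d) + excess k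
    #cores-suc 1≤r 1≤d k with <-cmp k d
    ... | tri< k<d _ _  = trans (#cores-below-d 1≤d k k<d) (cong (_+ 1) (#cores-∸d (<⇒≤ k<d)))
    ... | tri≈ _ refl _ = trans (#cores-at-d 1≤r 1≤d) (cong (_+ r) (#cores-∸d ≤-refl))
    ... | tri> _ _ d<k  =
      subst (λ k → #cores (suc k) ≡ #cores k + #cores (k ∸ d) + 0) (m+[n∸m]≡n d<k) (above (k ∸ suc d))
      where
      d+1+t∸d : ∀ t → suc d + t ∸ d ≡ suc t
      d+1+t∸d t = trans (cong (_∸ d) (sym (+-suc d t))) (m+n∸m≡n d (suc t))
      above : ∀ t → #cores (suc (suc d + t)) ≡ #cores (suc d + t) + #cores (suc d + t ∸ d) + 0
      above t = trans (#cores-above-d t)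
        (sym (trans (+-identityʳ _) (cong (λ z → #cores (suc d + t) + #cores z) (d+1+t∸d t))))

∑< : (ℕ → ℤ) → ℕ → ℤ
∑< t zero    = ℤ.0ℤ
∑< t (suc m) = ∑< t m ℤ.+ t m

∑<-zero : ∀ t m → (∀ k → k < m → t k ≡ ℤ.0ℤ) → ∑< t m ≡ ℤ.0ℤ
∑<-zero t zero    _    = refl
∑<-zero t (suc m) t≡0 = cong₂ ℤ._+_ (∑<-zero t m (λ k k<m → t≡0 k (m<n⇒m<1+n k<m))) (t≡0 m ≤-refl)

∑<-single : ∀ t m i → i < m → (∀ k → k < m → k ≢ i → t k ≡ ℤ.0ℤ) → ∑< t m ≡ t i
∑<-single t (suc m) i i<1+m t≡0 with i ≟ m
... | yes refl =
  trans (cong (ℤ._+ t i) (∑<-zero t m (λ k k<m → t≡0 k (m<n⇒m<1+n k<m) (<⇒≢ k<m)))) (ℤₚ.+-identityˡ (t i))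
... | no  i≢m  =
  trans (cong₂ ℤ._+_ (∑<-single t m i (≤∧≢⇒< (≤-pred i<1+m) i≢m) (λ k k<m → t≡0 k (m<n⇒m<1+n k<m)))
                     (t≡0 m ≤-refl (i≢m ∘ sym)))
        (ℤₚ.+-identityʳ (t i))

convAux≡∑< : ∀ f g n m → convAux f g n m ≡ ∑< (λ k → f k ℤ.* g (n ∸ k)) m
convAux≡∑< f g n zero    = refl
convAux≡∑< f g n (suc m) = cong (ℤ._+ f m ℤ.* g (n ∸ m)) (convAux≡∑< f g n m)

mon-≡ : ∀ c j → mon c j j ≡ c
mon-≡ c j rewrite dec-true (j ≟ j) refl = refl

mon-≢ : ∀ c j i → i ≢ j → mon c j i ≡ ℤ.0ℤ
mon-≢ c j i i≢j rewrite dec-false (i ≟ j) i≢j = refl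

⊛-⊖ʳ : ∀ f g h n → (f ⊛ (g ⊖ h)) n ≡ (f ⊛ g) n ℤ.- (f ⊛ h) n
⊛-⊖ʳ f g h n = go (suc n)
  where
  go : ∀ m → convAux f (g ⊖ h) n m ≡ convAux f g n m ℤ.- convAux f h n m
  go zero    = refl
  go (suc m) = trans (cong (ℤ._+ f m ℤ.* (g (n ∸ m) ℤ.- h (n ∸ m))) (go m))
                     (distrib (convAux f g n m) (convAux f h n m) (f m) (g (n ∸ m)) (h (n ∸ m)))
    where
    distrib : ∀ a b x y z → a ℤ.- b ℤ.+ x ℤ.* (y ℤ.- z) ≡ a ℤ.+ x ℤ.* y ℤ.- (b ℤ.+ x ℤ.* z)
    distrib = ℤ-Solver.solve-∀

⊛-congʳ : ∀ f {g h} → (∀ i → g i ≡ h i) → ∀ n → (f ⊛ g) n ≡ (f ⊛ h) n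
⊛-congʳ f {g} {h} g≗h n = go (suc n)
  where
  go : ∀ m → convAux f g n m ≡ convAux f h n m
  go zero    = refl
  go (suc m) = cong₂ ℤ._+_ (go m) (cong (f m ℤ.*_) (g≗h (n ∸ m)))

⊛-monʳ-≤ : ∀ f c j n → j ≤ n → (f ⊛ mon c j) n ≡ f (n ∸ j) ℤ.* c
⊛-monʳ-≤ f c j n j≤n = begin
  (f ⊛ mon c j) n                                   ≡⟨ convAux≡∑< f (mon c j) n (suc n) ⟩
  ∑< (λ k → f k ℤ.* mon c j (n ∸ k)) (suc n)        ≡⟨ ∑<-single _ (suc n) (n ∸ j) (s≤s (m∸n≤m n j)) off-diagonal ⟩
  f (n ∸ j) ℤ.* mon c j (n ∸ (n ∸ j))               ≡⟨ cong (λ i → f (n ∸ j) ℤ.* mon c j i) (m∸[m∸n]≡n j≤n) ⟩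
  f (n ∸ j) ℤ.* mon c j j                           ≡⟨ cong (f (n ∸ j) ℤ.*_) (mon-≡ c j) ⟩
  f (n ∸ j) ℤ.* c                                   ∎
  where
  open ≡-Reasoning
  off-diagonal : ∀ k → k < suc n → k ≢ n ∸ j → f k ℤ.* mon c j (n ∸ k) ≡ ℤ.0ℤ
  off-diagonal k k<1+n k≢ = trans (cong (f k ℤ.*_) (mon-≢ c j (n ∸ k) λ n∸k≡j →
                              k≢ (trans (sym (m∸[m∸n]≡n (≤-pred k<1+n))) (cong (n ∸_) n∸k≡j))))
                            (ℤₚ.*-zeroʳ (f k))

⊛-monʳ-> : ∀ f c j n → n < j → (f ⊛ mon c j) n ≡ ℤ.0ℤ
⊛-monʳ-> f c j n n<j = trans (convAux≡∑< f (mon c j) n (suc n)) (∑<-zero _ (suc n) vanishes)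
  where
  vanishes : ∀ k → k < suc n → f k ℤ.* mon c j (n ∸ k) ≡ ℤ.0ℤ
  vanishes k _ = trans (cong (f k ℤ.*_) (mon-≢ c j (n ∸ k) λ n∸k≡j → <⇒≱ n<j (subst (_≤ n) n∸k≡j (m∸n≤m n k))))
                       (ℤₚ.*-zeroʳ (f k))

-- For f with f 0 = 0 the truncated subtraction n ∸ j makes one formula cover both cases.
⊛-monʳ : ∀ f c j n → f 0 ≡ ℤ.0ℤ → (f ⊛ mon c j) n ≡ f (n ∸ j) ℤ.* c
⊛-monʳ f c j n f0≡0 with j ≤? n
... | yes j≤n = ⊛-monʳ-≤ f c j n j≤n
... | no  j≰n = trans (⊛-monʳ-> f c j n (≰⇒> j≰n))
                      (sym (trans (cong (λ i → f i ℤ.* c) (m≤n⇒m∸n≡0 (<⇒≤ (≰⇒> j≰n)))) (cong (ℤ._* c) f0≡0)))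

mon-⊛ : ∀ c j g n → j ≤ n → (mon c j ⊛ g) n ≡ c ℤ.* g (n ∸ j)
mon-⊛ c j g n j≤n = begin
  (mon c j ⊛ g) n                             ≡⟨ convAux≡∑< (mon c j) g n (suc n) ⟩
  ∑< (λ k → mon c j k ℤ.* g (n ∸ k)) (suc n)
    ≡⟨ ∑<-single _ (suc n) j (s≤s j≤n) (λ k _ k≢j → cong (ℤ._* g (n ∸ k)) (mon-≢ c j k k≢j)) ⟩
  mon c j j ℤ.* g (n ∸ j)                     ≡⟨ cong (ℤ._* g (n ∸ j)) (mon-≡ c j) ⟩
  c ℤ.* g (n ∸ j)                             ∎
  where open ≡-Reasoning

x·_ : Series → Series
(x· g) zero    = ℤ.0ℤ
(x· g) (suc i) = g i

⊛-x·ʳ : ∀ f g n → (f ⊛ x· g) (suc n) ≡ (f ⊛ g) n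
⊛-x·ʳ f g n =
  trans (cong₂ ℤ._+_ (go (suc n) ≤-refl) (trans (cong (λ i → f (suc n) ℤ.* (x· g) i) (n∸n≡0 n)) (ℤₚ.*-zeroʳ (f (suc n)))))
        (ℤₚ.+-identityʳ _)
  where
  go : ∀ m → m ≤ suc n → convAux f (x· g) (suc n) m ≡ convAux f g n m
  go zero    _         = refl
  go (suc m) (s≤s m≤n) = cong₂ ℤ._+_ (go m (m≤n⇒m≤1+n m≤n)) (cong (λ i → f m ℤ.* (x· g) i) (+-∸-assoc 1 m≤n))

module _ (d r : ℕ) where

  coreSeries : Series
  coreSeries k = ℤ.+ #cores d r k

  P : Series
  P = mon ℤ.1ℤ 0 ⊖ mon ℤ.1ℤ 1 ⊖ mon ℤ.1ℤ (suc d)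

  -- numer d r = x · S
  S : Series
  S = mon ℤ.1ℤ 0 ⊕ mon (ℤ.+ (r ∸ 1)) d ⊖ mon (ℤ.+ r) (suc d)

  denom≗P-x·P : ∀ i → denom d i ≡ (P ⊖ x· P) i
  denom≗P-x·P zero    = trans (⊛-⊖ʳ P (mon ℤ.1ℤ 0) (mon ℤ.1ℤ 1) 0)
    (cong₂ ℤ._-_ (trans (⊛-monʳ-≤ P ℤ.1ℤ 0 0 z≤n) (ℤₚ.*-identityʳ (P 0))) (⊛-monʳ-> P ℤ.1ℤ 1 0 (s≤s z≤n)))
  denom≗P-x·P (suc i) = trans (⊛-⊖ʳ P (mon ℤ.1ℤ 0) (mon ℤ.1ℤ 1) (suc i))
    (cong₂ ℤ._-_ (trans (⊛-monʳ-≤ P ℤ.1ℤ 0 (suc i) z≤n) (ℤₚ.*-identityʳ (P (suc i))))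
                 (trans (⊛-monʳ-≤ P ℤ.1ℤ 1 (suc i) (s≤s z≤n)) (ℤₚ.*-identityʳ (P i))))

  coreSeries⊛P : ∀ n → (coreSeries ⊛ P) n ≡ coreSeries n ℤ.- coreSeries (n ∸ 1) ℤ.- coreSeries (n ∸ suc d)
  coreSeries⊛P n = trans (⊛-⊖ʳ coreSeries (mon ℤ.1ℤ 0 ⊖ mon ℤ.1ℤ 1) (mon ℤ.1ℤ (suc d)) n)
    (cong₂ ℤ._-_ (trans (⊛-⊖ʳ coreSeries (mon ℤ.1ℤ 0) (mon ℤ.1ℤ 1) n) (cong₂ ℤ._-_ (at 0) (at 1))) (at (suc d)))
    where
    at : ∀ j → (coreSeries ⊛ mon ℤ.1ℤ j) n ≡ coreSeries (n ∸ j)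
    at j = trans (⊛-monʳ coreSeries ℤ.1ℤ j n refl) (ℤₚ.*-identityʳ _)

  coreSeries⊛P-suc : 1 ≤ r → 1 ≤ d → ∀ k → (coreSeries ⊛ P) (suc k) ≡ ℤ.+ excess d r k
  coreSeries⊛P-suc 1≤r 1≤d k = begin
    (coreSeries ⊛ P) (suc k)                                    ≡⟨ coreSeries⊛P (suc k) ⟩
    ℤ.+ #cores d r (suc k) ℤ.- ℤ.+ a ℤ.- ℤ.+ b
      ≡⟨ cong (λ z → ℤ.+ z ℤ.- ℤ.+ a ℤ.- ℤ.+ b) (#cores-suc d r 1≤r 1≤d k) ⟩
    ℤ.+ (a + b + c) ℤ.- ℤ.+ a ℤ.- ℤ.+ b
      ≡⟨ cong (λ z → z ℤ.- ℤ.+ a ℤ.- ℤ.+ b) (trans (ℤₚ.pos-+ (a + b) c) (cong (ℤ._+ ℤ.+ c) (ℤₚ.pos-+ a b))) ⟩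
    ℤ.+ a ℤ.+ ℤ.+ b ℤ.+ ℤ.+ c ℤ.- ℤ.+ a ℤ.- ℤ.+ b
      ≡⟨ cancel (ℤ.+ a) (ℤ.+ b) (ℤ.+ c) ⟩
    ℤ.+ c ∎
    where
    open ≡-Reasoning
    a b c : ℕ
    a = #cores d r k
    b = #cores d r (k ∸ d)
    c = excess d r k
    cancel : ∀ a b c → a ℤ.+ b ℤ.+ c ℤ.- a ℤ.- b ≡ c
    cancel = ℤ-Solver.solve-∀

  S-at : ∀ i {a b c} → mon ℤ.1ℤ 0 i ≡ a → mon (ℤ.+ (r ∸ 1)) d i ≡ b → mon (ℤ.+ r) (suc d) i ≡ c → S i ≡ a ℤ.+ b ℤ.- c
  S-at i ≡a ≡b ≡c = cong₂ ℤ._-_ (cong₂ ℤ._+_ ≡a ≡b) ≡c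

  S≡Δexcess : 1 ≤ r → ∀ k → S (suc k) ≡ ℤ.+ excess d r (suc k) ℤ.- ℤ.+ excess d r k
  S≡Δexcess 1≤r k = by-cases (<-cmp (suc k) d)
    where
    by-cases : Tri (suc k < d) (suc k ≡ d) (d < suc k) → S (suc k) ≡ ℤ.+ excess d r (suc k) ℤ.- ℤ.+ excess d r k
    by-cases (tri< k+1<d _ _) =
      trans (S-at (suc k) (mon-≢ ℤ.1ℤ 0 (suc k) λ ()) (mon-≢ _ d (suc k) (<⇒≢ k+1<d))
                          (mon-≢ _ (suc d) (suc k) (<⇒≢ (m<n⇒m<1+n k+1<d))))
            (sym (cong₂ (λ a b → ℤ.+ a ℤ.- ℤ.+ b) (excess-< d r k+1<d) (excess-< d r (<-trans (n<1+n k) k+1<d))))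
    by-cases (tri≈ _ k+1≡d _) =
      trans (S-at (suc k) (mon-≢ ℤ.1ℤ 0 (suc k) λ ()) (trans (cong (mon _ d) k+1≡d) (mon-≡ _ d))
                          (mon-≢ _ (suc d) (suc k) (<⇒≢ (≤-trans (n<1+n (suc k)) (s≤s (≤-reflexive k+1≡d))))))
            (trans (ℤₚ.+-identityʳ _)
              (sym (trans (cong₂ (λ a b → ℤ.+ a ℤ.- ℤ.+ b) (trans (cong (excess d r) k+1≡d) (excess-≡ d r))
                                                            (excess-< d r (≤-reflexive k+1≡d)))
                          (ℤₚ.⊖-≥ 1≤r))))
    by-cases (tri> _ _ d<k+1) = above-d (k ≟ d)
      where
      above-d : Dec (k ≡ d) → S (suc k) ≡ ℤ.+ excess d r (suc k) ℤ.- ℤ.+ excess d r k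
      above-d (yes k≡d) = subst (λ k → S (suc k) ≡ ℤ.+ excess d r (suc k) ℤ.- ℤ.+ excess d r k) (sym k≡d)
        (trans (S-at (suc d) (mon-≢ ℤ.1ℤ 0 (suc d) λ ()) (mon-≢ _ d (suc d) (<⇒≢ (n<1+n d) ∘ sym)) (mon-≡ _ (suc d)))
               (sym (cong₂ (λ a b → ℤ.+ a ℤ.- ℤ.+ b) (excess-> d r (n<1+n d)) (excess-≡ d r))))
      above-d (no k≢d) =
        trans (S-at (suc k) (mon-≢ ℤ.1ℤ 0 (suc k) λ ()) (mon-≢ _ d (suc k) (<⇒≢ d<k+1 ∘ sym))
                            (mon-≢ _ (suc d) (suc k) (k≢d ∘ suc-injective)))
              (sym (cong₂ (λ a b → ℤ.+ a ℤ.- ℤ.+ b) (excess-> d r d<k+1)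
                                                    (excess-> d r (≤∧≢⇒< (≤-pred d<k+1) (k≢d ∘ sym)))))

  coreSeries⊛denom : 1 ≤ r → 1 ≤ d → ∀ n → (coreSeries ⊛ denom d) n ≡ numer d r n
  coreSeries⊛denom 1≤r 1≤d zero    = refl
  coreSeries⊛denom 1≤r 1≤d (suc m) = begin
    (coreSeries ⊛ denom d) (suc m)                                   ≡⟨ ⊛-congʳ coreSeries denom≗P-x·P (suc m) ⟩
    (coreSeries ⊛ (P ⊖ x· P)) (suc m)                                ≡⟨ ⊛-⊖ʳ coreSeries P (x· P) (suc m) ⟩
    (coreSeries ⊛ P) (suc m) ℤ.- (coreSeries ⊛ x· P) (suc m)         ≡⟨ cong (λ z → (coreSeries ⊛ P) (suc m) ℤ.- z) (⊛-x·ʳ coreSeries P m) ⟩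
    (coreSeries ⊛ P) (suc m) ℤ.- (coreSeries ⊛ P) m                  ≡⟨ cong (ℤ._- (coreSeries ⊛ P) m) (coreSeries⊛P-suc 1≤r 1≤d m) ⟩
    ℤ.+ excess d r m ℤ.- (coreSeries ⊛ P) m                          ≡⟨ Δexcess m ⟨
    S m                                                              ≡⟨ ℤₚ.*-identityˡ (S m) ⟨
    ℤ.1ℤ ℤ.* S m                                                     ≡⟨ mon-⊛ ℤ.1ℤ 1 S (suc m) (s≤s z≤n) ⟨
    numer d r (suc m)                                                ∎
    where
    open ≡-Reasoning
    Δexcess : ∀ m → S m ≡ ℤ.+ excess d r m ℤ.- (coreSeries ⊛ P) m
    Δexcess zero    = trans (S-at 0 (mon-≡ _ 0) (mon-≢ _ d 0 (<⇒≢ 1≤d)) (mon-≢ (ℤ.+ r) (suc d) 0 λ ()))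
                            (cong (λ e → ℤ.+ e ℤ.- ℤ.0ℤ) (sym (excess-< d r {0} 1≤d)))
    Δexcess (suc k) =
      trans (S≡Δexcess 1≤r k) (cong (λ z → ℤ.+ excess d r (suc k) ℤ.- z) (sym (coreSeries⊛P-suc 1≤r 1≤d k)))

open import Data.Integer using (+_)

theorem5p2 : (d r : ℕ) → 1 ≤ r → r ≤ d →
    Σ (ℕ → ℕ) (λ N →
      ((s : ℕ) → 1 ≤ s → HasCount (CoreDD d r s) (N s)) ×
      N 0 ≡ 0 ×
      ((n : ℕ) → ((λ k → + N k) ⊛ denom d) n ≡ numer d r n))
theorem5p2 d r 1≤r r≤d =
  #cores d r , count-cores d r 1≤r r≤d , refl , coreSeries⊛denom d r 1≤r (≤-trans 1≤r r≤d)
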